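{- Let $B_n\subseteq\{0,1\}^n$ and $S_n := \{k\in[n]\mid \{k\}\text{ is a part of }\mathbf{SP}(B_n)\}$. Let $A_n \subseteq B_n$ with $|A_n|\le |S_n|/2$ be such that, writing $\mathcal{Q}_{A_n} := \{\bigcap_{a\in A_n}\mathbf{SP}(a)(k)\mid k\in[n]\}$, every part $P\in\mathcal{Q}_{A_n}$ satisfies either $|P\cap S_n|\le 2$, or $|P\cap S_n|>2$ and every $b\in B_n\setminus A_n$ is either constant on $P\cap S_n$, or $b[P\cap S_n]$ is imbalanced (exactly one $0$ and $1$s elsewhere, or vice versa) and $b$ is constant on $P'\cap S_n$ for every $P'\in\mathcal{Q}_{A_n}$ with $P'\neq P$, $|P'\cap S_n|>2$ (such $A_n$ exists). Let $p : A_n \to B_n$ be an injective function, let $\Gamma_p := \{ \pi \in \mathbf{Stab}(B_n) \mid \pi(p(a)) = a \text{ for all } a \in A_n \}$, and let $P_{>2} := \{k \in S_n \mid |P(k) \cap S_n| > 2\}$, where $P(k) \in \mathcal{Q}_{A_n}$ is the part containing $k$. Then for any $\pi, \pi' \in \Gamma_p$ such that $\pi^{ -1}|_{([n] \setminus P_{>2})} = \pi'^{ -1}|_{([n] \setminus P_{>2})}$, it also holds $\pi^{ -1}|_{P_{>2}} = \pi'^{ -1}|_{P_{>2}}$.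
   Context: $\mathbf{Sym}_n$ acts on $\{0,1\}^n$ by permuting positions: $\pi(v) = v_{\pi^{ -1}(1)}\cdots v_{\pi^{ -1}(n)}$, and this extends to sets of strings; $\mathbf{Stab}(B_n)=\{\pi\in\mathbf{Sym}_n\mid\pi(B_n)=B_n\}$. $\mathbf{SP}(B_n)$ is the coarsest partition $\mathcal{P}$ of $[n]$ such that every $\pi\in\mathbf{Sym}_n$ fixing each part of $\mathcal{P}$ setwise stabilises $B_n$; for a string $a$, $\mathbf{SP}(a)$ is the partition into positions with $0$ and with $1$. $\mathcal{P}(k)$ is the part containing $k$; $b[X]$ is the substring of $b$ at positions $X$. -}

module Defs where

open import Data.Bool using (Bool; not)
open import Data.Bool.Properties using () renaming (_≟_ to _≟ᵇ_)
open import Data.Nat using (ℕ; _≤_; _>_)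
open import Data.Nat.Properties using () renaming (_≟_ to _≟ℕ_)
open import Data.Fin using (Fin) renaming (_≟_ to _≟ᶠ_)
open import Data.Fin.Properties using (all?)
open import Data.Fin.Permutation using (Permutation′; _⟨$⟩ʳ_; _⟨$⟩ˡ_)
open import Data.Vec using (Vec; lookup; tabulate)
open import Data.List using (List; length; filter; allFin)
open import Data.List.Membership.Propositional using (_∈_)
open import Data.List.Relation.Unary.All using (All)
import Data.List.Relation.Unary.All as All
open import Data.Product using (Σ; _×_; _,_; ∃-syntax)
open import Data.Sum using (_⊎_)
open import Relation.Nullary using (¬_; Dec)
open import Relation.Nullary.Decidable using (_×-dec_; _→-dec_)
open import Relation.Binary.PropositionalEquality using (_≡_; _≢_)

-- Binary strings of length n: {0,1}^n, with Bool (false = 0, true = 1).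
Str : ℕ → Set
Str n = Vec Bool n

-- Action of Sym_n on strings: π(v)_i = v_{π⁻¹(i)}.
act : ∀ {n} → Permutation′ n → Str n → Str n
act π v = tabulate (λ i → lookup v (π ⟨$⟩ˡ i))

-- A finite set of strings is represented by a list (membership _∈_).
-- π(B) = B, i.e. {π v | v ∈ B} = B, written out as two inclusions.
Stabilises : ∀ {n} → Permutation′ n → List (Str n) → Set
Stabilises π B =
  (∀ v → v ∈ B → act π v ∈ B) × (∀ w → w ∈ B → ∃[ v ] (v ∈ B × act π v ≡ w))

-- A partition of [n] is given by a labelling c : Fin n → ℕ ; parts are the
-- fibres of c.  π fixes each part setwise iff c ∘ π = c.
FixesParts : ∀ {n} → (Fin n → ℕ) → Permutation′ n → Set
FixesParts c π = ∀ i → c (π ⟨$⟩ʳ i) ≡ c i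

Supports : ∀ {n} → List (Str n) → (Fin n → ℕ) → Set
Supports B c = ∀ (π : Permutation′ _) → FixesParts c π → Stabilises π B

-- c is (a labelling of) SP(B): the coarsest supporting partition, i.e. it is
-- supporting and every supporting partition c' refines it.
IsSP : ∀ {n} → List (Str n) → (Fin n → ℕ) → Set
IsSP B c = Supports B c × (∀ c' → Supports B c' → ∀ i j → c' i ≡ c' j → c i ≡ c j)

InS : ∀ {n} → (Fin n → ℕ) → Fin n → Set
InS c k = ∀ j → c j ≡ c k → j ≡ k

InS? : ∀ {n} (c : Fin n → ℕ) (k : Fin n) → Dec (InS c k)
InS? c k = all? (λ j → (c j ≟ℕ c k) →-dec (j ≟ᶠ k))

-- j and k lie in the same part of Q_A = { ⋂_{a∈A} SP(a)(k) | k ∈ [n] }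
SameQ : ∀ {n} → List (Str n) → Fin n → Fin n → Set
SameQ A j k = All (λ a → lookup a j ≡ lookup a k) A

SameQ? : ∀ {n} (A : List (Str n)) (j k : Fin n) → Dec (SameQ A j k)
SameQ? A j k = All.all? (λ a → lookup a j ≟ᵇ lookup a k) A

InPS : ∀ {n} → (Fin n → ℕ) → List (Str n) → Fin n → Fin n → Set
InPS c A k j = InS c j × SameQ A j k

InPS? : ∀ {n} (c : Fin n → ℕ) (A : List (Str n)) (k j : Fin n) → Dec (InPS c A k j)
InPS? c A k j = InS? c j ×-dec SameQ? A j k

sizeS : ∀ {n} → (Fin n → ℕ) → ℕ
sizeS {n} c = length (filter (InS? c) (allFin n))

sizePS : ∀ {n} → (Fin n → ℕ) → List (Str n) → Fin n → ℕ
sizePS {n} c A k = length (filter (InPS? c A k) (allFin n))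

ConstOn : ∀ {n} → Str n → (Fin n → Set) → Set
ConstOn b X = ∀ x y → X x → X y → lookup b x ≡ lookup b y

Imbalanced : ∀ {n} → Str n → (Fin n → Set) → Set
Imbalanced b X = Σ Bool λ v → Σ _ λ x →
  X x × lookup b x ≡ v × (∀ y → X y → y ≢ x → lookup b y ≡ not v)

PartCondition : ∀ {n} → List (Str n) → (Fin n → ℕ) → List (Str n) → Fin n → Set
PartCondition B c A k =
  sizePS c A k ≤ 2 ⊎
  (sizePS c A k > 2 ×
    (∀ b → b ∈ B → ¬ (b ∈ A) →
       ConstOn b (InPS c A k) ⊎
       (Imbalanced b (InPS c A k) ×
        (∀ k' → ¬ SameQ A k' k → sizePS c A k' > 2 → ConstOn b (InPS c A k')))))

InΓ : ∀ {n} → List (Str n) → List (Str n) → (Str n → Str n) → Permutation′ n → Set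
InΓ B A p π = Stabilises π B × (∀ a → a ∈ A → act π (p a) ≡ a)

InP>2 : ∀ {n} → (Fin n → ℕ) → List (Str n) → Fin n → Set
InP>2 c A k = InS c k × sizePS c A k > 2

{-# OPTIONS --safe #-}
-- For π, π′ ∈ Γ_p the permutation σ = π′π⁻¹ stabilises B, fixes every a ∈ A
-- (both send p(a) to a) and, by hypothesis, fixes [n] ∖ P_{>2} pointwise; it suffices to
-- show that σ also fixes P_{>2} pointwise.  Since σ fixes each a ∈ A, it maps every part
-- of Q_A to itself.  Suppose j = σ⁻¹(k) ≠ k for some k ∈ P_{>2}; then j ∈ P(k) ∩ S, and the
-- transposition (k j) stabilises B: a string b ∈ B with b[k] = b[j] is fixed by it, and
-- otherwise b[P(k) ∩ S] is imbalanced with its odd position x ∈ {k, j} while b is constant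
-- on every other large part, so b ∘ (k j) = b ∘ σ⁻¹ (if x = j) or b ∘ σ (if x = k), both
-- in B.  But then moving j into the part {k} of SP(B) yields a coarser supporting
-- partition, contradicting the maximality of SP(B).
module Submission where

open import Defs
open import Data.Nat using (ℕ; _≤_; _>_; _*_; _<?_)
open import Data.Nat.Properties using (<⇒≱)
open import Data.Bool using (Bool; not)
open import Data.Bool.Properties using () renaming (_≟_ to _≟ᵇ_)
open import Data.Fin using (Fin; _≟_)
open import Data.Fin.Permutation
  using (Permutation′; _⟨$⟩ˡ_; _⟨$⟩ʳ_; inverseˡ; inverseʳ; flip; _∘ₚ_; transpose)
import Data.Fin.Permutation.Components as PC
open import Data.Vec using (lookup)
open import Data.Vec.Properties using (lookup∘tabulate; tabulate∘lookup; tabulate-cong; ≡-dec)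
open import Data.List using (List; length)
open import Data.List.Membership.Propositional using (_∈_)
import Data.List.Membership.DecPropositional as DecMembership
open import Data.List.Relation.Unary.Unique.Propositional using (Unique)
import Data.List.Relation.Unary.All as All
open import Data.Product using (_,_; proj₁; proj₂)
open import Data.Sum using (_⊎_; inj₁; inj₂; [_,_]′)
open import Relation.Nullary using (¬_; yes; no; contradiction)
open import Relation.Nullary.Decidable using (decidable-stable; _×-dec_)
open import Relation.Unary using (Decidable)
open import Function using (_∘′_)
open import Relation.Binary.PropositionalEquality
  using (_≡_; _≢_; refl; sym; trans; cong; subst; module ≡-Reasoning)

private
  variable
    n : ℕ

module _ (i j : Fin n) where

  transpose-elim : (P : Fin n → Fin n → Set) → P i j → P j i →
                   (∀ l → l ≢ i → l ≢ j → P l l) → ∀ l → P l (PC.transpose i j l)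
  transpose-elim P pᵢ pⱼ pₗ l with l ≟ i
  ... | yes refl = pᵢ
  ... | no l≢i with l ≟ j
  ...   | yes refl = pⱼ
  ...   | no l≢j = pₗ l l≢i l≢j

  transpose-left : PC.transpose i j i ≡ j
  transpose-left with i ≟ i
  ... | yes _ = refl
  ... | no i≢i = contradiction refl i≢i

  transpose-right : PC.transpose i j j ≡ i
  transpose-right with j ≟ i
  ... | yes j≡i = j≡i
  ... | no _ with j ≟ j
  ...   | yes _ = refl
  ...   | no j≢j = contradiction refl j≢j

  transpose-other : ∀ {l} → l ≢ i → l ≢ j → PC.transpose i j l ≡ l
  transpose-other {l} l≢i l≢j with l ≟ i
  ... | yes l≡i = contradiction l≡i l≢i
  ... | no _ with l ≟ j
  ...   | yes l≡j = contradiction l≡j l≢j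
  ...   | no _ = refl

  transpose-involutive : ∀ l → PC.transpose i j (PC.transpose i j l) ≡ l
  transpose-involutive = transpose-elim (λ a b → PC.transpose i j b ≡ a)
    transpose-right transpose-left (λ l l≢i l≢j → transpose-other l≢i l≢j)

⟨$⟩ˡ-injective : (π : Permutation′ n) {i j : Fin n} → π ⟨$⟩ˡ i ≡ π ⟨$⟩ˡ j → i ≡ j
⟨$⟩ˡ-injective π {i} {j} eq = begin
  i                   ≡⟨ inverseʳ π ⟨
  π ⟨$⟩ʳ (π ⟨$⟩ˡ i)  ≡⟨ cong (π ⟨$⟩ʳ_) eq ⟩
  π ⟨$⟩ʳ (π ⟨$⟩ˡ j)  ≡⟨ inverseʳ π ⟩
  j                   ∎
  where open ≡-Reasoning

⟨$⟩ʳ-injective : (π : Permutation′ n) {i j : Fin n} → π ⟨$⟩ʳ i ≡ π ⟨$⟩ʳ j → i ≡ j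
⟨$⟩ʳ-injective π = ⟨$⟩ˡ-injective (flip π)

fixes-outside⇒preserves : ∀ {P : Fin n → Set} → Decidable P → (π : Permutation′ n) →
  (∀ i → ¬ P i → π ⟨$⟩ˡ i ≡ i) → ∀ {i} → P i → P (π ⟨$⟩ˡ i)
fixes-outside⇒preserves {P = P} P? π fixes {i} Pi = decidable-stable (P? (π ⟨$⟩ˡ i)) λ ¬Pπi →
  ¬Pπi (subst P (sym (⟨$⟩ˡ-injective π (fixes (π ⟨$⟩ˡ i) ¬Pπi))) Pi)

lookup-act : (π : Permutation′ n) (v : Str n) (i : Fin n) →
             lookup (act π v) i ≡ lookup v (π ⟨$⟩ˡ i)
lookup-act π v = lookup∘tabulate _

act-cong : (π σ : Permutation′ n) (v : Str n) →
           (∀ i → lookup v (π ⟨$⟩ˡ i) ≡ lookup v (σ ⟨$⟩ˡ i)) → act π v ≡ act σ v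
act-cong π σ v = tabulate-cong

act-fix : (π : Permutation′ n) (v : Str n) → (∀ i → lookup v (π ⟨$⟩ˡ i) ≡ lookup v i) →
          act π v ≡ v
act-fix π v eq = trans (tabulate-cong eq) (tabulate∘lookup v)

act-∘ : (π σ : Permutation′ n) (v : Str n) → act (π ∘ₚ σ) v ≡ act σ (act π v)
act-∘ π σ v = tabulate-cong λ i → sym (lookup-act π v (σ ⟨$⟩ˡ i))

act-flip-act : (π : Permutation′ n) (v : Str n) → act (flip π) (act π v) ≡ v
act-flip-act π v = trans (sym (act-∘ π (flip π) v))
  (act-fix (π ∘ₚ flip π) v λ i → cong (lookup v) (inverseˡ π))

act-transpose-involutive : (i j : Fin n) (v : Str n) →
  act (transpose i j) (act (transpose i j) v) ≡ v
act-transpose-involutive i j v = trans (sym (act-∘ (transpose i j) (transpose i j) v))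
  (act-fix (transpose i j ∘ₚ transpose i j) v λ l → cong (lookup v) (transpose-involutive j i l))

act-transpose-same : (i j : Fin n) (v : Str n) → lookup v i ≡ lookup v j →
  act (transpose i j) v ≡ v
act-transpose-same i j v vᵢ≡vⱼ = act-fix (transpose i j) v
  (transpose-elim j i (λ a b → lookup v b ≡ lookup v a) vᵢ≡vⱼ (sym vᵢ≡vⱼ) (λ _ _ _ → refl))

module _ {B : List (Str n)} where

  Stabilises-cong : (π σ : Permutation′ n) → (∀ v → act π v ≡ act σ v) →
                    Stabilises π B → Stabilises σ B
  Stabilises-cong π σ eq (into , onto) =
      (λ v v∈B → subst (_∈ B) (eq v) (into v v∈B))
    , (λ w w∈B → let (v , v∈B , πv≡w) = onto w w∈B in v , v∈B , trans (sym (eq v)) πv≡w)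

  Stabilises-∘ : (π σ : Permutation′ n) → Stabilises π B → Stabilises σ B → Stabilises (π ∘ₚ σ) B
  Stabilises-∘ π σ (intoπ , ontoπ) (intoσ , ontoσ) =
      (λ v v∈B → subst (_∈ B) (sym (act-∘ π σ v)) (intoσ _ (intoπ v v∈B)))
    , λ w w∈B → let (u , u∈B , σu≡w) = ontoσ w w∈B
                    (v , v∈B , πv≡u) = ontoπ u u∈B
                in v , v∈B , trans (act-∘ π σ v) (trans (cong (act σ) πv≡u) σu≡w)

  Stabilises-flip : (π : Permutation′ n) → Stabilises π B → Stabilises (flip π) B
  Stabilises-flip π (into , onto) =
      (λ w w∈B → let (v , v∈B , πv≡w) = onto w w∈B in
                 subst (_∈ B) (trans (sym (act-flip-act π v)) (cong (act (flip π)) πv≡w)) v∈B)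
    , λ v v∈B → act π v , into v v∈B , act-flip-act π v

  Stabilises-∘-cancel : (π σ : Permutation′ n) → Stabilises (π ∘ₚ σ) B → Stabilises σ B →
                        Stabilises π B
  Stabilises-∘-cancel π σ stab-πσ stab-σ =
    Stabilises-cong πσσ⁻¹ π
      (λ v → act-cong πσσ⁻¹ π v λ i → cong (lookup v ∘′ (π ⟨$⟩ˡ_)) (inverseˡ σ))
      (Stabilises-∘ (π ∘ₚ σ) (flip σ) stab-πσ (Stabilises-flip σ stab-σ))
    where
    πσσ⁻¹ : Permutation′ n
    πσσ⁻¹ = (π ∘ₚ σ) ∘ₚ flip σ

  involution-closed⇒Stabilises : (π : Permutation′ n) → (∀ v → act π (act π v) ≡ v) →
    (∀ v → v ∈ B → act π v ∈ B) → Stabilises π B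
  involution-closed⇒Stabilises π invol into = into , λ w w∈B → act π w , into w w∈B , invol w

FixesParts-∘ : (c : Fin n → ℕ) (π σ : Permutation′ n) →
               FixesParts c π → FixesParts c σ → FixesParts c (π ∘ₚ σ)
FixesParts-∘ c π σ fixesπ fixesσ i = trans (fixesσ (π ⟨$⟩ʳ i)) (fixesπ i)

module _ {B : List (Str n)} {sp : Fin n → ℕ} (isSP : IsSP B sp) {k : Fin n} (singleton : InS sp k)
         (j : Fin n) (closed : ∀ b → b ∈ B → act (transpose k j) b ∈ B) where

  private
    sp′ : Fin n → ℕ
    sp′ i with i ≟ j
    ... | yes _ = sp k
    ... | no _ = sp i

    sp′-j : sp′ j ≡ sp k
    sp′-j with j ≟ j
    ... | yes _ = refl
    ... | no j≢j = contradiction refl j≢j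

    sp′-k : sp′ k ≡ sp k
    sp′-k with k ≟ j
    ... | yes _ = refl
    ... | no _ = refl

    sp′-other : ∀ {i} → i ≢ j → sp′ i ≡ sp i
    sp′-other {i} i≢j with i ≟ j
    ... | yes i≡j = contradiction i≡j i≢j
    ... | no _ = refl

    sp′-part-of-k : ∀ {i} → sp′ i ≡ sp k → i ≡ k ⊎ i ≡ j
    sp′-part-of-k {i} eq with i ≟ j
    ... | yes i≡j = inj₂ i≡j
    ... | no _ = inj₁ (singleton i eq)

    fixes-k⇒FixesParts : ∀ π → FixesParts sp′ π → π ⟨$⟩ʳ k ≡ k → FixesParts sp π
    fixes-k⇒FixesParts π fixes πk≡k i with i ≟ k
    ... | yes refl = cong sp πk≡k
    ... | no i≢k with i ≟ j
    ...   | yes refl = [ (λ πj≡k → contradiction (⟨$⟩ʳ-injective π (trans πj≡k (sym πk≡k))) i≢k)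
                       , cong sp ]′ (sp′-part-of-k (trans (fixes j) sp′-j))
    ...   | no i≢j with π ⟨$⟩ʳ i ≟ j
    ...     | yes πi≡j = contradiction (singleton i spᵢ≡spₖ) i≢k
      where
      spᵢ≡spₖ : sp i ≡ sp k
      spᵢ≡spₖ = begin
        sp i            ≡⟨ sp′-other i≢j ⟨
        sp′ i           ≡⟨ fixes i ⟨
        sp′ (π ⟨$⟩ʳ i)  ≡⟨ cong sp′ πi≡j ⟩
        sp′ j           ≡⟨ sp′-j ⟩
        sp k            ∎
        where open ≡-Reasoning
    ...     | no πi≢j = trans (sym (sp′-other πi≢j)) (trans (fixes i) (sp′-other i≢j))

    τ : Permutation′ n
    τ = transpose k j

    τ-FixesParts : FixesParts sp′ τ
    τ-FixesParts = transpose-elim k j (λ a b → sp′ b ≡ sp′ a)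
      (trans sp′-j (sym sp′-k)) (trans sp′-k (sym sp′-j)) (λ _ _ _ → refl)

    τ-Stabilises : Stabilises τ B
    τ-Stabilises = involution-closed⇒Stabilises τ (act-transpose-involutive k j) closed

    Supports-sp′ : Supports B sp′
    Supports-sp′ π fixes with sp′-part-of-k (trans (fixes k) sp′-k)
    ... | inj₁ πk≡k = proj₁ isSP π (fixes-k⇒FixesParts π fixes πk≡k)
    ... | inj₂ πk≡j = Stabilises-∘-cancel π τ (proj₁ isSP (π ∘ₚ τ) fixes-πτ) τ-Stabilises
      where
      fixes-πτ : FixesParts sp (π ∘ₚ τ)
      fixes-πτ = fixes-k⇒FixesParts (π ∘ₚ τ) (FixesParts-∘ sp′ π τ fixes τ-FixesParts)
        (trans (cong (PC.transpose k j) πk≡j) (transpose-right k j))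

  transpose-closed-singleton⇒≡ : j ≡ k
  transpose-closed-singleton⇒≡ =
    singleton j (proj₂ isSP sp′ Supports-sp′ j k (trans sp′-j (sym sp′-k)))

SameQ-refl : (A : List (Str n)) (i : Fin n) → SameQ A i i
SameQ-refl A i = All.tabulate λ _ → refl

SameQ-sym : {A : List (Str n)} {i j : Fin n} → SameQ A i j → SameQ A j i
SameQ-sym = All.map sym

SameQ-trans : {A : List (Str n)} {i j l : Fin n} → SameQ A i j → SameQ A j l → SameQ A i l
SameQ-trans s t = All.zipWith (λ (e , e′) → trans e e′) (s , t)

module _ (sp : Fin n → ℕ) (A : List (Str n)) where

  InP>2? : Decidable (InP>2 sp A)
  InP>2? i = InS? sp i ×-dec (2 <? sizePS sp A i)

  record PreservesQ (g : Permutation′ n) : Set where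
    field
      fixes-outside : ∀ i → ¬ InP>2 sp A i → g ⟨$⟩ˡ i ≡ i
      within-Q      : ∀ i → SameQ A (g ⟨$⟩ˡ i) i

    preserves-P>2 : ∀ {i} → InP>2 sp A i → InP>2 sp A (g ⟨$⟩ˡ i)
    preserves-P>2 = fixes-outside⇒preserves InP>2? g fixes-outside

    InPS-image : ∀ {i k} → InP>2 sp A i → SameQ A i k → InPS sp A k (g ⟨$⟩ˡ i)
    InPS-image i∈P>2 i~k = proj₁ (preserves-P>2 i∈P>2) , SameQ-trans (within-Q _) i~k

  act-≡-if-same-preimage : (g g′ : Permutation′ n) → PreservesQ g → PreservesQ g′ →
    ∀ {k} (b : Str n) (x : Fin n) (c : Bool) →
    (∀ z → InPS sp A k z → z ≢ x → lookup b z ≡ c) →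
    (∀ k′ → ¬ SameQ A k′ k → sizePS sp A k′ > 2 → ConstOn b (InPS sp A k′)) →
    ∀ y → g ⟨$⟩ˡ y ≡ x → g′ ⟨$⟩ˡ y ≡ x → act g b ≡ act g′ b
  act-≡-if-same-preimage g g′ pg pg′ {k} b x c off-x const y gy≡x g′y≡x =
    act-cong g g′ b pointwise
    where
    module G = PreservesQ pg
    module G′ = PreservesQ pg′

    avoids : ∀ (h : Permutation′ n) {i} → h ⟨$⟩ˡ y ≡ x → i ≢ y → h ⟨$⟩ˡ i ≢ x
    avoids h hy≡x i≢y hi≡x = i≢y (⟨$⟩ˡ-injective h (trans hi≡x (sym hy≡x)))

    pointwise : ∀ i → lookup b (g ⟨$⟩ˡ i) ≡ lookup b (g′ ⟨$⟩ˡ i)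
    pointwise i with InP>2? i
    ... | no outside =
      cong (lookup b) (trans (G.fixes-outside i outside) (sym (G′.fixes-outside i outside)))
    ... | yes i∈P>2 with SameQ? A i k
    ...   | no i≁k = const i i≁k (proj₂ i∈P>2) _ _
                       (G.InPS-image i∈P>2 (SameQ-refl A i)) (G′.InPS-image i∈P>2 (SameQ-refl A i))
    ...   | yes i~k with i ≟ y
    ...     | yes refl = cong (lookup b) (trans gy≡x (sym g′y≡x))
    ...     | no i≢y = trans (off-x _ (G.InPS-image i∈P>2 i~k) (avoids g gy≡x i≢y))
                         (sym (off-x _ (G′.InPS-image i∈P>2 i~k) (avoids g′ g′y≡x i≢y)))

module _ (B : List (Str n)) (sp : Fin n → ℕ) (A : List (Str n)) where

  record Admissible (σ : Permutation′ n) : Set where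
    field
      stabilises    : Stabilises σ B
      fixes-A       : ∀ a → a ∈ A → act σ a ≡ a
      fixes-outside : ∀ i → ¬ InP>2 sp A i → σ ⟨$⟩ˡ i ≡ i

    preservesQ : PreservesQ sp A σ
    preservesQ = record
      { fixes-outside = fixes-outside
      ; within-Q      = λ i → All.tabulate λ {a} a∈A →
          trans (sym (lookup-act σ a i)) (cong (λ v → lookup v i) (fixes-A a a∈A))
      }

  open Admissible

  Admissible-flip : (σ : Permutation′ n) → Admissible σ → Admissible (flip σ)
  Admissible-flip σ adm = record
    { stabilises    = Stabilises-flip σ (stabilises adm)
    ; fixes-A       = λ a a∈A →
        trans (cong (act (flip σ)) (sym (fixes-A adm a a∈A))) (act-flip-act σ a)
    ; fixes-outside = λ i outside →
        trans (cong (σ ⟨$⟩ʳ_) (sym (fixes-outside adm i outside))) (inverseʳ σ)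
    }

  module _ (isSP : IsSP B sp) (conditions : ∀ k → PartCondition B sp A k)
           {σ : Permutation′ n} (adm : Admissible σ) {k : Fin n} (k∈P>2 : InP>2 sp A k) where

    private
      open DecMembership (≡-dec {n = n} _≟ᵇ_) using (_∈?_)

      j : Fin n
      j = σ ⟨$⟩ˡ k

      τ : Permutation′ n
      τ = transpose k j

      j∈P>2 : InP>2 sp A j
      j∈P>2 = PreservesQ.preserves-P>2 (preservesQ adm) k∈P>2

      j~k : SameQ A j k
      j~k = PreservesQ.within-Q (preservesQ adm) k

      k∈PS : InPS sp A k k
      k∈PS = proj₁ k∈P>2 , SameQ-refl A k

      j∈PS : InPS sp A k j
      j∈PS = proj₁ j∈P>2 , j~k

      τ-preservesQ : PreservesQ sp A τ
      τ-preservesQ = record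
        { fixes-outside = transpose-elim j k (λ a b → ¬ InP>2 sp A a → b ≡ a)
            (contradiction j∈P>2) (contradiction k∈P>2) (λ _ _ _ _ → refl)
        ; within-Q      = transpose-elim j k (λ a b → SameQ A b a)
            (SameQ-sym j~k) j~k (λ l _ _ → SameQ-refl A l)
        }

      unchanged : ∀ {b} → b ∈ B → lookup b k ≡ lookup b j → act τ b ∈ B
      unchanged {b} b∈B bₖ≡bⱼ = subst (_∈ B) (sym (act-transpose-same k j b bₖ≡bⱼ)) b∈B

      via-admissible : ∀ {b} → b ∈ B → (x : Fin n) (c : Bool) →
        (∀ z → InPS sp A k z → z ≢ x → lookup b z ≡ c) →
        (∀ k′ → ¬ SameQ A k′ k → sizePS sp A k′ > 2 → ConstOn b (InPS sp A k′)) →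
        ∀ {g} → Admissible g → ∀ y → g ⟨$⟩ˡ y ≡ x → τ ⟨$⟩ˡ y ≡ x → act τ b ∈ B
      via-admissible {b} b∈B x c off-x const {g} adm-g y gy≡x τy≡x =
        subst (_∈ B)
          (act-≡-if-same-preimage sp A g τ (preservesQ adm-g) τ-preservesQ
            b x c off-x const y gy≡x τy≡x)
          (proj₁ (stabilises adm-g) b b∈B)

    Admissible⇒transpose-closed : ∀ b → b ∈ B → act (transpose k (σ ⟨$⟩ˡ k)) b ∈ B
    Admissible⇒transpose-closed b b∈B with b ∈? A
    ... | yes b∈A = unchanged b∈B (sym (All.lookup j~k b∈A))
    ... | no b∉A with conditions k
    ...   | inj₁ small = contradiction small (<⇒≱ (proj₂ k∈P>2))
    ...   | inj₂ (_ , condition) with condition b b∈B b∉A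
    ...     | inj₁ const = unchanged b∈B (const k j k∈PS j∈PS)
    ...     | inj₂ ((c , x , _ , _ , off-x) , const) with x ≟ k | x ≟ j
    ...       | yes refl | _ = via-admissible b∈B x (not c) off-x const
                                 (Admissible-flip σ adm) j (inverseʳ σ) (transpose-left j k)
    ...       | _ | yes refl = via-admissible b∈B x (not c) off-x const
                                 adm k refl (transpose-right j k)
    ...       | no x≢k | no x≢j = unchanged b∈B
                  (trans (off-x k k∈PS (x≢k ∘′ sym)) (sym (off-x j j∈PS (x≢j ∘′ sym))))

  Admissible⇒fixes-P>2 : IsSP B sp → (∀ k → PartCondition B sp A k) →
    ∀ {σ} → Admissible σ → ∀ k → InP>2 sp A k → σ ⟨$⟩ˡ k ≡ k
  Admissible⇒fixes-P>2 isSP conditions {σ} adm k k∈P>2 =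
    transpose-closed-singleton⇒≡ isSP (proj₁ k∈P>2) (σ ⟨$⟩ˡ k)
      (Admissible⇒transpose-closed isSP conditions adm k∈P>2)

InΓ⇒Admissible : ∀ {B A : List (Str n)} {sp} (p : Str n → Str n) (π π′ : Permutation′ n) →
  InΓ B A p π → InΓ B A p π′ → (∀ k → ¬ InP>2 sp A k → π ⟨$⟩ˡ k ≡ π′ ⟨$⟩ˡ k) →
  Admissible B sp A (flip π ∘ₚ π′)
InΓ⇒Admissible p π π′ (stabπ , πp) (stabπ′ , π′p) agree = record
  { stabilises    = Stabilises-∘ (flip π) π′ (Stabilises-flip π stabπ) stabπ′
  ; fixes-A       = fixes-A
  ; fixes-outside = λ i outside → trans (cong (π ⟨$⟩ʳ_) (sym (agree i outside))) (inverseʳ π)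
  }
  where
  fixes-A : ∀ a → a ∈ _ → act (flip π ∘ₚ π′) a ≡ a
  fixes-A a a∈A = begin
    act (flip π ∘ₚ π′) a                  ≡⟨ act-∘ (flip π) π′ a ⟩
    act π′ (act (flip π) a)               ≡⟨ cong (act π′ ∘′ act (flip π)) (πp a a∈A) ⟨
    act π′ (act (flip π) (act π (p a)))   ≡⟨ cong (act π′) (act-flip-act π (p a)) ⟩
    act π′ (p a)                          ≡⟨ π′p a a∈A ⟩
    a                                     ∎
    where open ≡-Reasoning

lemma30 : (n : ℕ) (B : List (Str n)) (sp : Fin n → ℕ) → IsSP B sp →
    (A : List (Str n)) → Unique A → (∀ a → a ∈ A → a ∈ B) →
    2 * length A ≤ sizeS sp →
    (∀ k → PartCondition B sp A k) →
    (p : Str n → Str n) → (∀ a → a ∈ A → p a ∈ B) →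
    (∀ a a' → a ∈ A → a' ∈ A → p a ≡ p a' → a ≡ a') →
    (π π' : Permutation′ n) → InΓ B A p π → InΓ B A p π' →
    (∀ k → ¬ InP>2 sp A k → π ⟨$⟩ˡ k ≡ π' ⟨$⟩ˡ k) →
    ∀ k → InP>2 sp A k → π ⟨$⟩ˡ k ≡ π' ⟨$⟩ˡ k
lemma30 n B sp isSP A _ _ _ conditions p _ _ π π′ Γπ Γπ′ agree k k∈P>2 = begin
  π ⟨$⟩ˡ k                        ≡⟨ cong (π ⟨$⟩ˡ_) σk≡k ⟨
  π ⟨$⟩ˡ (π ⟨$⟩ʳ (π′ ⟨$⟩ˡ k))    ≡⟨ inverseˡ π ⟩
  π′ ⟨$⟩ˡ k                       ∎
  where
  open ≡-Reasoning
  σk≡k : (flip π ∘ₚ π′) ⟨$⟩ˡ k ≡ k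
  σk≡k = Admissible⇒fixes-P>2 B sp A isSP conditions
           (InΓ⇒Admissible p π π′ Γπ Γπ′ agree) k k∈P>2
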